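{- A graph $G$ is a convex geometry in the triangle path convexity if and only if $G$ is a forest.
   Context: Graphs are finite and simple. A path $P$ in $G$ is a triangle path if any two vertices of $P$ whose distance along $P$ is greater than $2$ are non-adjacent in $G$. A set $S\subseteq V(G)$ is convex in the triangle path convexity if for any $x,y\in S$, every vertex lying on some triangle path between $x$ and $y$ belongs to $S$. The convex hull $H(S)$ of $S$ is the smallest convex set containing $S$. A vertex $x$ of a convex set $S$ is an extreme vertex of $S$ if $S\setminus\{x\}$ is convex; $\mathit{ext}(S)$ denotes the set of extreme vertices of $S$. $G$ is a convex geometry (with respect to the convexity) if every convex set $S\subseteq V(G)$ satisfies $S=H(\mathit{ext}(S))$. -}

module Defs where

open import Data.Nat using (ℕ; _+_; _≤_; _<_)
open import Data.Bool using (Bool; true; false)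
open import Data.Fin using (Fin; toℕ)
open import Data.Fin.Subset using (Subset; _∈_; _─_; ⁅_⁆)
open import Data.List using (List; []; _∷_; _++_; [_]; length; lookup; head; last)
open import Data.List.Relation.Unary.Linked using (Linked)
open import Data.List.Relation.Unary.Unique.Propositional using (Unique)
import Data.List.Membership.Propositional as LM
open import Data.Maybe using (just)
open import Data.Product using (Σ; ∃; _×_)
open import Relation.Binary.PropositionalEquality using (_≡_)
open import Relation.Nullary using (¬_)
open import Function.Bundles using (_⇔_)

record Graph : Set where
  field
    n      : ℕ
    adj    : Fin n → Fin n → Bool
    sym    : ∀ u v → adj u v ≡ adj v u
    irrefl : ∀ v → adj v v ≡ false

module _ (G : Graph) where
  open Graph G

  Vertex : Set
  Vertex = Fin n

  Adj : Vertex → Vertex → Set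
  Adj u v = adj u v ≡ true

  IsPath : List Vertex → Set
  IsPath p = Unique p × Linked Adj p

  IsTrianglePath : List Vertex → Set
  IsTrianglePath p = IsPath p ×
    (∀ (i j : Fin (length p)) → toℕ i + 2 < toℕ j →
       adj (lookup p i) (lookup p j) ≡ false)

  TrianglePathBetween : Vertex → Vertex → List Vertex → Set
  TrianglePathBetween x y p = IsTrianglePath p × head p ≡ just x × last p ≡ just y

  Convex : Subset n → Set
  Convex S = ∀ x y → x ∈ S → y ∈ S → ∀ (p : List Vertex) →
    TrianglePathBetween x y p → ∀ v → v LM.∈ p → v ∈ S

  IsExtreme : Subset n → Vertex → Set
  IsExtreme S x = x ∈ S × Convex (S ─ ⁅ x ⁆)

  InHull : (Vertex → Set) → Vertex → Set
  InHull T v = ∀ (C : Subset n) → Convex C → (∀ u → T u → u ∈ C) → v ∈ C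

  IsConvexGeometry : Set
  IsConvexGeometry = ∀ (S : Subset n) → Convex S →
    ∀ v → (v ∈ S ⇔ InHull (IsExtreme S) v)

  HasCycle : Set
  HasCycle = Σ Vertex λ x → Σ (List Vertex) λ p →
    Unique (x ∷ p) × 2 ≤ length p × Linked Adj (x ∷ p ++ [ x ])

  IsForest : Set
  IsForest = ¬ HasCycle

{-# OPTIONS --safe #-}
module Submission where

-- Every path on three vertices is a triangle path, so a vertex of a convex set S is
-- extreme exactly when it has at most one neighbour in S (a "leaf" of S).
--
-- If G has a cycle, delete leaves from V(G) one at a time: the set stays convex and
-- never loses a cycle vertex, so it ends as a nonempty convex set without leaves,
-- i.e. without extreme vertices, which is therefore not the hull of its extreme vertices.
--
-- If G is a forest, a chord of a path would close a cycle, so every path is a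
-- triangle path.  A vertex v ∈ S with two neighbours in S lies on a path whose ends
-- are leaves of S, found by walking away from v inside S in both directions (in a
-- forest such a walk never revisits a vertex).  Both ends are extreme, so v lies in
-- every convex set containing the extreme vertices of S.

open import Data.Bool using (true)
import Data.Bool.Properties as Bool
open import Data.Fin using (Fin; zero; suc; toℕ)
import Data.Fin.Properties as Fin
open import Data.Fin.Subset using (Subset; _∈_; _∉_; _─_; _-_; _⊂_; ⁅_⁆; ⊥; ⊤; inside; outside)
open import Data.Fin.Subset.Properties
  using (_∈?_; ∈⊤; ∉⊥; p─q⊆p; x∈p∧x≢y⇒x∈p-y; x∉⁅y⁆⇒x≢y; x∈p⇒p-x⊂p)
open import Data.Fin.Subset.Induction using (⊂-wellFounded)
open import Data.List using (List; []; _∷_; _++_; [_]; _∷ʳ_; length; lookup; head; last; reverse)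
open import Data.List.Properties using (++-assoc; unfold-reverse; reverse-++; length-++)
open import Data.List.Relation.Unary.All as All using (All; []; _∷_)
import Data.List.Relation.Unary.All.Properties as All
open import Data.List.Relation.Unary.AllPairs using ([]; _∷_)
open import Data.List.Relation.Unary.Any using (here; there)
open import Data.List.Relation.Unary.Linked as Linked using (Linked; []; [-]; _∷_)
open import Data.List.Relation.Unary.Linked.Properties as Linked using ()
open import Data.List.Relation.Unary.Unique.Propositional using (Unique)
open import Data.List.Membership.Propositional using () renaming (_∈_ to _∈ₗ_; _∉_ to _∉ₗ_)
open import Data.List.Membership.Propositional.Properties using (∈-++⁺ˡ; ∈-++⁺ʳ; ∈-∃++; ∈-lookup)
open import Data.Maybe using (Maybe; just; nothing)
open import Data.Maybe.Properties using (just-injective)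
open import Data.Maybe.Relation.Binary.Connected using (Connected; just)
open import Data.Nat using (zero; suc; _+_; _≤_; _<_; z≤n; s≤s)
open import Data.Nat.Properties using (≮⇒≥; <⇒≱; <⇒≤; ≤-trans; m≤n+m; m<m+n; +-comm; +-suc)
open import Data.Product using (∃; ∃₂; _×_; _,_; proj₁; proj₂)
open import Data.Vec.Base as Vec using (_∷_)
open import Function.Bundles using (_⇔_; mk⇔; Equivalence)
open import Induction.WellFounded using (Acc; acc)
open import Relation.Binary.Definitions using (DecidableEquality; Symmetric)
open import Relation.Binary.PropositionalEquality
  using (_≡_; _≢_; refl; sym; trans; cong; subst; ≢-sym; setoid; module ≡-Reasoning)
open import Relation.Nullary using (¬_; Dec; yes; no; contradiction)
open import Relation.Nullary.Decidable using (_×-dec_; ¬?)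

open import Defs

module _ {A : Set} where

  last-∷ʳ : (xs : List A) (y : A) → last (xs ∷ʳ y) ≡ just y
  last-∷ʳ []            y = refl
  last-∷ʳ (x ∷ [])      y = refl
  last-∷ʳ (x ∷ x′ ∷ xs) y = last-∷ʳ (x′ ∷ xs) y

  last-++-∷ : (xs : List A) (y : A) (ys : List A) → last (xs ++ y ∷ ys) ≡ last (y ∷ ys)
  last-++-∷ []            y ys = refl
  last-++-∷ (x ∷ [])      y ys = refl
  last-++-∷ (x ∷ x′ ∷ xs) y ys = last-++-∷ (x′ ∷ xs) y ys

  last-reverse : (xs : List A) → last (reverse xs) ≡ head xs
  last-reverse []       = refl
  last-reverse (x ∷ xs) = trans (cong last (unfold-reverse x xs)) (last-∷ʳ (reverse xs) x)

  lookup-∃++ : (xs : List A) (k : Fin (length xs)) →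
               ∃₂ λ ys zs → xs ≡ ys ++ lookup xs k ∷ zs × length ys ≡ toℕ k
  lookup-∃++ (x ∷ xs) zero    = [] , xs , refl , refl
  lookup-∃++ (x ∷ xs) (suc k) with ys , zs , eq , len ← lookup-∃++ xs k =
    x ∷ ys , zs , cong (x ∷_) eq , cong suc len

  choose-avoiding : DecidableEquality A → ∀ {P : A → Set} {a b} → a ≢ b → P a → P b →
                    (m : Maybe A) → ∃ λ w → P w × m ≢ just w
  choose-avoiding _≟_         a≢b pa pb nothing  = _ , pa , λ ()
  choose-avoiding _≟_ {a = a} a≢b pa pb (just z) with a ≟ z
  ... | yes refl = _ , pb , λ eq → a≢b (just-injective eq)
  ... | no  a≢z  = _ , pa , λ eq → a≢z (sym (just-injective eq))

module _ {A : Set} where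

  open import Data.List.Relation.Binary.Permutation.Setoid (setoid A) using (↭-sym)
  open import Data.List.Relation.Binary.Permutation.Setoid.Properties (setoid A)
    using (Unique-resp-↭; ↭-reverse)

  Unique-lookup-≢ : ∀ {xs : List A} → Unique xs →
                    ∀ {i j : Fin (length xs)} → toℕ i < toℕ j → lookup xs i ≢ lookup xs j
  Unique-lookup-≢ (x∉ ∷ _) {zero}  {suc j} _       = All.lookup x∉ (∈-lookup j)
  Unique-lookup-≢ (_  ∷ u) {suc i} {suc j} (s≤s h) = Unique-lookup-≢ u h

  Unique-++⁻ˡ : ∀ xs {ys : List A} → Unique (xs ++ ys) → Unique xs
  Unique-++⁻ˡ []       _        = []
  Unique-++⁻ˡ (x ∷ xs) (x∉ ∷ u) = All.++⁻ˡ xs x∉ ∷ Unique-++⁻ˡ xs u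

  Unique-++⇒disjoint : ∀ xs {ys : List A} {a b} → Unique (xs ++ ys) → a ∈ₗ xs → b ∈ₗ ys → a ≢ b
  Unique-++⇒disjoint (x ∷ xs) (x∉ ∷ _) (here refl) b∈ = All.lookup x∉ (∈-++⁺ʳ xs b∈)
  Unique-++⇒disjoint (x ∷ xs) (_  ∷ u) (there a∈)  b∈ = Unique-++⇒disjoint xs u a∈ b∈

  Unique-reverse⁺ : ∀ {xs : List A} → Unique xs → Unique (reverse xs)
  Unique-reverse⁺ {xs} = Unique-resp-↭ (↭-sym (↭-reverse xs))

module _ {A : Set} {R : A → A → Set} where

  Linked-++⁻ˡ : ∀ xs {ys} → Linked R (xs ++ ys) → Linked R xs
  Linked-++⁻ˡ []           _       = []
  Linked-++⁻ˡ (x ∷ [])     _       = [-]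
  Linked-++⁻ˡ (x ∷ y ∷ xs) (r ∷ l) = r ∷ Linked-++⁻ˡ (y ∷ xs) l

  Linked-edge : ∀ xs {y z zs} → Linked R (xs ++ y ∷ z ∷ zs) → R y z
  Linked-edge []       l = Linked.head l
  Linked-edge (x ∷ xs) l = Linked-edge xs (Linked.tail l)

  Linked-predecessor : ∀ x xs {y ys} → Linked R (x ∷ xs ++ y ∷ ys) → ∃ λ a → a ∈ₗ x ∷ xs × R a y
  Linked-predecessor x []        (r ∷ _) = x , here refl , r
  Linked-predecessor x (x′ ∷ xs) (_ ∷ l) with a , a∈ , r ← Linked-predecessor x′ xs l =
    a , there a∈ , r

  Linked-∷ʳ⁺ : ∀ {xs y z} → Linked R xs → last xs ≡ just y → R y z → Linked R (xs ∷ʳ z)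
  Linked-∷ʳ⁺ {z = z} l eq r =
    Linked.++⁺ l (subst (λ m → Connected R m (just z)) (sym eq) (just r)) [-]

  Linked-reverse⁺ : Symmetric R → ∀ {xs} → Linked R xs → Linked R (reverse xs)
  Linked-reverse⁺ R-sym []  = []
  Linked-reverse⁺ R-sym [-] = [-]
  Linked-reverse⁺ R-sym {x ∷ y ∷ xs} (r ∷ l) =
    subst (Linked R) (sym (unfold-reverse x (y ∷ xs)))
      (Linked-∷ʳ⁺ (Linked-reverse⁺ R-sym l) (last-reverse (y ∷ xs)) (R-sym r))

Unique⇒length≤ : ∀ {m} {xs : List (Fin m)} → Unique xs → length xs ≤ m
Unique⇒length≤ {xs = xs} u = ≮⇒≥ λ m<len →
  let i , j , i<j , eq = Fin.pigeonhole m<len (lookup xs) in Unique-lookup-≢ u i<j eq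

x∈p─q⇒x∉q : ∀ {m} (p q : Subset m) {x} → x ∈ p ─ q → x ∉ q
x∈p─q⇒x∉q (inside ∷ p) (outside ∷ q) Vec.here ()
x∈p─q⇒x∉q (_      ∷ p) (_       ∷ q) (Vec.there h) (Vec.there h′) = x∈p─q⇒x∉q p q h h′

x∈p-y⇒x≢y : ∀ {m} {p : Subset m} {x y} → x ∈ p - y → x ≢ y
x∈p-y⇒x≢y {p = p} {y = y} x∈ = x∉⁅y⁆⇒x≢y (x∈p─q⇒x∉q p ⁅ y ⁆ x∈)

module _ (G : Graph) where

  open Graph G using (n; adj; irrefl)

  private
    V : Set
    V = Vertex G

  Adj-sym : Symmetric (Adj G)
  Adj-sym {u} {v} e = trans (Graph.sym G v u) e

  Adj⇒≢ : ∀ {u v} → Adj G u v → u ≢ v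
  Adj⇒≢ {u} e refl with () ← trans (sym e) (irrefl u)

  TwoNeighboursIn : (V → Set) → V → Set
  TwoNeighboursIn P x = ∃₂ λ a b → a ≢ b × P a × P b × Adj G x a × Adj G x b

  TwoNeighboursIn-mono : ∀ {P Q : V → Set} {x} → (∀ {v} → P v → Q v) →
                         TwoNeighboursIn P x → TwoNeighboursIn Q x
  TwoNeighboursIn-mono P⊆Q (a , b , a≢b , Pa , Pb , xa , xb) = a , b , a≢b , P⊆Q Pa , P⊆Q Pb , xa , xb

  twoNeighboursIn? : ∀ S x → Dec (TwoNeighboursIn (_∈ S) x)
  twoNeighboursIn? S x = Fin.any? λ a → Fin.any? λ b →
    ¬? (a Fin.≟ b) ×-dec a ∈? S ×-dec b ∈? S ×-dec adj x a Bool.≟ true ×-dec adj x b Bool.≟ true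

  LeafOf : Subset n → V → Set
  LeafOf S x = x ∈ S × ¬ TwoNeighboursIn (_∈ S) x

  leafOf? : ∀ S x → Dec (LeafOf S x)
  leafOf? S x = x ∈? S ×-dec ¬? (twoNeighboursIn? S x)

  edge-path : ∀ {u v} → Adj G u v → IsPath G (u ∷ v ∷ [])
  edge-path e = (Adj⇒≢ e ∷ []) ∷ [] ∷ [] , e ∷ [-]

  path-reverse : ∀ {p} → IsPath G p → IsPath G (reverse p)
  path-reverse (u , l) = Unique-reverse⁺ u , Linked-reverse⁺ Adj-sym l

  path-inner-twoNeighbours : ∀ {p x y z} → IsPath G p → head p ≡ just y → last p ≡ just z →
                             x ∈ₗ p → x ≢ y → x ≢ z → TwoNeighboursIn (_∈ₗ p) x
  path-inner-twoNeighbours (u , l) hd lt x∈p x≢y x≢z with ∈-∃++ x∈p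
  ... | []     , _      , refl = contradiction (just-injective hd) x≢y
  ... | a₀ ∷ as , []     , refl =
    contradiction (just-injective (trans (sym (last-∷ʳ (a₀ ∷ as) _)) lt)) x≢z
  ... | a₀ ∷ as , b ∷ bs , refl with a , a∈ , ax ← Linked-predecessor a₀ as l =
    a , b , Unique-++⇒disjoint (a₀ ∷ as) u a∈ (there (here refl)) ,
    ∈-++⁺ˡ a∈ , ∈-++⁺ʳ (a₀ ∷ as) (there (here refl)) , Adj-sym ax , Linked-edge (a₀ ∷ as) l

  triangle-path₃ : ∀ {x a b} → Adj G x a → Adj G x b → a ≢ b → TrianglePathBetween G a b (a ∷ x ∷ b ∷ [])
  triangle-path₃ xa xb a≢b =
    ((((≢-sym (Adj⇒≢ xa) ∷ a≢b ∷ []) ∷ (Adj⇒≢ xb ∷ []) ∷ [] ∷ []) , Adj-sym xa ∷ xb ∷ [-]) ,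
      λ i j i+2<j → contradiction (≤-trans (Fin.toℕ≤pred[n] j) (m≤n+m 2 (toℕ i))) (<⇒≱ i+2<j)) ,
    refl , refl

  ⊤-convex : Convex G ⊤
  ⊤-convex _ _ _ _ _ _ _ _ = ∈⊤

  ⊥-convex : Convex G ⊥
  ⊥-convex _ _ x∈⊥ _ _ _ _ _ = contradiction x∈⊥ ∉⊥

  leaf⇒extreme : ∀ {S x} → Convex G S → LeafOf S x → IsExtreme G S x
  leaf⇒extreme {S} {x} cS (x∈S , ¬two) = x∈S , convex-S-x
    where
    convex-S-x : Convex G (S ─ ⁅ x ⁆)
    convex-S-x y z y∈ z∈ p tp@((pth , _) , hd , lt) v v∈p = x∈p∧x≢y⇒x∈p-y (p⊆S v∈p) v≢x
      where
      p⊆S : ∀ {w} → w ∈ₗ p → w ∈ S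
      p⊆S = cS y z (p─q⊆p S ⁅ x ⁆ y∈) (p─q⊆p S ⁅ x ⁆ z∈) p tp _
      v≢x : v ≢ x
      v≢x refl = ¬two (TwoNeighboursIn-mono p⊆S
        (path-inner-twoNeighbours pth hd lt v∈p (≢-sym (x∈p-y⇒x≢y y∈)) (≢-sym (x∈p-y⇒x≢y z∈))))

  extreme⇒leaf : ∀ {S x} → IsExtreme G S x → LeafOf S x
  extreme⇒leaf {S} {x} (x∈S , convex-S-x) = x∈S , λ (a , b , a≢b , a∈S , b∈S , xa , xb) →
    x∈p-y⇒x≢y (convex-S-x a b (x∈p∧x≢y⇒x∈p-y a∈S (≢-sym (Adj⇒≢ xa)))
                              (x∈p∧x≢y⇒x∈p-y b∈S (≢-sym (Adj⇒≢ xb)))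
                              _ (triangle-path₃ xa xb a≢b) x (there (here refl)))
              refl

  cycle-twoNeighbours : ∀ {x p v} → Unique (x ∷ p) → 2 ≤ length p → Linked (Adj G) (x ∷ p ++ [ x ]) →
                        v ∈ₗ x ∷ p → TwoNeighboursIn (_∈ₗ x ∷ p) v
  cycle-twoNeighbours {x} {p₁ ∷ p₂ ∷ ps} (_ ∷ p₁∉ ∷ _) _ W (here refl)
    with l , l∈ , lx ← Linked-predecessor p₂ ps (Linked.tail (Linked.tail W)) =
    p₁ , l , All.lookup p₁∉ l∈ , there (here refl) , there (there l∈) , Linked.head W , Adj-sym lx
  cycle-twoNeighbours {p = _ ∷ []} _ (s≤s ()) _ (here refl)
  cycle-twoNeighbours {x} {p} (x∉ ∷ u) len W (there v∈p) with as , bs , refl ← ∈-∃++ v∈p =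
    inner as bs x∉ u len (subst (λ q → Linked (Adj G) (x ∷ q)) (++-assoc as (_ ∷ bs) [ x ]) W)
    where
    inner : ∀ {x v} as bs → All (x ≢_) (as ++ v ∷ bs) → Unique (as ++ v ∷ bs) →
            2 ≤ length (as ++ v ∷ bs) → Linked (Adj G) (x ∷ as ++ v ∷ bs ++ [ x ]) →
            TwoNeighboursIn (_∈ₗ x ∷ as ++ v ∷ bs) v
    inner [] [] _ _ (s≤s ()) _
    inner [] (b ∷ bs) (_ ∷ x≢b ∷ _) _ _ W =
      _ , b , x≢b , here refl , there (there (here refl)) , Adj-sym (Linked.head W) , Linked-edge [ _ ] W
    inner {x} (a₀ ∷ as) [] x∉ _ _ W with a , a∈ , av ← Linked-predecessor a₀ as (Linked.tail W) =
      a , x , ≢-sym (All.lookup x∉ (∈-++⁺ˡ a∈)) , there (∈-++⁺ˡ a∈) , here refl ,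
      Adj-sym av , Linked-edge (x ∷ a₀ ∷ as) W
    inner {x} (a₀ ∷ as) (b ∷ bs) _ u _ W with a , a∈ , av ← Linked-predecessor a₀ as (Linked.tail W) =
      a , b , Unique-++⇒disjoint (a₀ ∷ as) u a∈ (there (here refl)) , there (∈-++⁺ˡ a∈) ,
      there (∈-++⁺ʳ (a₀ ∷ as) (there (here refl))) , Adj-sym av , Linked-edge (x ∷ a₀ ∷ as) W

  peelLeaves : (K : V → Set) → (∀ {v} → K v → TwoNeighboursIn K v) →
               ∀ S → Convex G S → (∀ {v} → K v → v ∈ S) →
               ∃ λ T → Convex G T × (∀ {v} → K v → v ∈ T) × (∀ v → ¬ LeafOf T v)
  peelLeaves K K-core S = go S (⊂-wellFounded S)
    where
    go : ∀ S → Acc _⊂_ S → Convex G S → (∀ {v} → K v → v ∈ S) →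
         ∃ λ T → Convex G T × (∀ {v} → K v → v ∈ T) × (∀ v → ¬ LeafOf T v)
    go S (acc smaller) cS K⊆S with Fin.any? (leafOf? S)
    ... | no  leafless    = S , cS , K⊆S , λ v leaf → leafless (v , leaf)
    ... | yes (v , leaf) =
      go (S - v) (smaller (x∈p⇒p-x⊂p (proj₁ leaf))) (proj₂ (leaf⇒extreme cS leaf)) K⊆S-v
      where
      K⊆S-v : ∀ {u} → K u → u ∈ S - v
      K⊆S-v Ku = x∈p∧x≢y⇒x∈p-y (K⊆S Ku) λ { refl → proj₂ leaf (TwoNeighboursIn-mono K⊆S (K-core Ku)) }

  convexGeometry⇒leafless-empty : IsConvexGeometry G → ∀ {T} → Convex G T → (∀ v → ¬ LeafOf T v) →
                                  ∀ v → v ∉ T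
  convexGeometry⇒leafless-empty cg {T} cT leafless v v∈T =
    ∉⊥ (Equivalence.to (cg T cT v) v∈T ⊥ ⊥-convex λ u ext → contradiction (extreme⇒leaf ext) (leafless u))

  convexGeometry⇒forest : IsConvexGeometry G → IsForest G
  convexGeometry⇒forest cg (x , p , u , len , W)
    with T , cT , cycle⊆T , leafless ←
           peelLeaves (_∈ₗ x ∷ p) (cycle-twoNeighbours u len W) ⊤ ⊤-convex (λ _ → ∈⊤) =
    convexGeometry⇒leafless-empty cg cT leafless x (cycle⊆T (here refl))

  path-closing-edge⇒cycle : ∀ {x y w} ys zs → IsPath G (x ∷ y ∷ ys ++ w ∷ zs) → Adj G w x → HasCycle G
  path-closing-edge⇒cycle {x} {y} {w} ys zs (u , l) wx =
    x , y ∷ ys ∷ʳ w , Unique-++⁻ˡ (x ∷ y ∷ ys ∷ʳ w) (subst Unique split u) ,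
    s≤s (subst (1 ≤_) (sym (length-++ ys)) (m≤n+m 1 (length ys))) ,
    Linked-∷ʳ⁺ (Linked-++⁻ˡ (x ∷ y ∷ ys ∷ʳ w) (subst (Linked (Adj G)) split l)) (last-∷ʳ (x ∷ y ∷ ys) w) wx
    where
    split : x ∷ y ∷ ys ++ w ∷ zs ≡ (x ∷ y ∷ ys ∷ʳ w) ++ zs
    split = cong (λ q → x ∷ y ∷ q) (sym (++-assoc ys [ w ] zs))

  forest⇒path-chordless : IsForest G → ∀ {p} → IsPath G p → ∀ {i j : Fin (length p)} →
                          suc (toℕ i) < toℕ j → ¬ Adj G (lookup p i) (lookup p j)
  forest⇒path-chordless forest {x ∷ p} pth {zero} {suc j} (s≤s 1≤j) e with lookup-∃++ p j
  ... | []     , _  , _  , len = contradiction (subst (1 ≤_) (sym len) 1≤j) λ ()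
  ... | y ∷ ys , zs , eq , _   =
    forest (path-closing-edge⇒cycle ys zs (subst (λ q → IsPath G (x ∷ q)) eq pth) (Adj-sym e))
  forest⇒path-chordless forest {x ∷ p} (_ ∷ u , l) {suc i} {suc j} (s≤s h) =
    forest⇒path-chordless forest (u , Linked.tail l) h

  forest⇒trianglePath : IsForest G → ∀ {p} → IsPath G p → IsTrianglePath G p
  forest⇒trianglePath forest pth = pth , λ i j i+2<j →
    Bool.¬-not (forest⇒path-chordless forest pth (subst (_≤ toℕ j) (+-comm (toℕ i) 2) (<⇒≤ i+2<j)))

  forest-path-extend : IsForest G → ∀ {w y r} → IsPath G (y ∷ r) → Adj G y w → head r ≢ just w →
                       IsPath G (w ∷ y ∷ r)
  forest-path-extend forest {w} {y} {r} (u , l) yw w≢next =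
    (≢-sym (Adj⇒≢ yw) ∷ All.¬Any⇒All¬ r w∉r) ∷ u , Adj-sym yw ∷ l
    where
    w∉r : w ∉ₗ r
    w∉r w∈r with ∈-∃++ w∈r
    ... | []     , _  , refl = w≢next refl
    ... | _ ∷ zs , zs′ , refl = forest (path-closing-edge⇒cycle zs zs′ (u , l) (Adj-sym yw))

  forest-extendToLeaf : IsForest G → ∀ S {y r} → IsPath G (y ∷ r) → y ∈ S →
                        ∃₂ λ ℓ e → LeafOf S ℓ × IsPath G (e ++ y ∷ r) × head (e ++ y ∷ r) ≡ just ℓ
  forest-extendToLeaf forest S pth y∈S = go n (m<m+n n (s≤s z≤n)) pth y∈S
    where
    go : ∀ k {y r} → n < k + length (y ∷ r) → IsPath G (y ∷ r) → y ∈ S →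
         ∃₂ λ ℓ e → LeafOf S ℓ × IsPath G (e ++ y ∷ r) × head (e ++ y ∷ r) ≡ just ℓ
    go zero    n<len pth _ = contradiction (Unique⇒length≤ (proj₁ pth)) (<⇒≱ n<len)
    go (suc k) {y} {r} n<len pth y∈S with twoNeighboursIn? S y
    ... | no  ¬two = y , [] , (y∈S , ¬two) , pth , refl
    ... | yes (a , b , a≢b , a∈S , b∈S , ya , yb)
      with w , (w∈S , yw) , w≢next ← choose-avoiding Fin._≟_ a≢b (a∈S , ya) (b∈S , yb) (head r)
      with ℓ , e , leaf , pth′ , hd ← go k (subst (n <_) (sym (+-suc k (length (y ∷ r)))) n<len)
                                          (forest-path-extend forest pth yw w≢next) w∈S =
      ℓ , e ∷ʳ w , leaf ,
      subst (λ q → IsPath G q × head q ≡ just ℓ) (sym (++-assoc e [ w ] (y ∷ r))) (pth′ , hd)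

  forest-leafPathThrough : IsForest G → ∀ S {v} → TwoNeighboursIn (_∈ S) v →
                           ∃₂ λ ℓ₁ ℓ₂ → LeafOf S ℓ₁ × LeafOf S ℓ₂ ×
                             ∃ λ p → TrianglePathBetween G ℓ₁ ℓ₂ p × v ∈ₗ p
  forest-leafPathThrough forest S {v} (a , b , a≢b , a∈S , b∈S , va , vb)
    with ℓ₂ , e₂ , leaf₂ , pth₂ , hd₂ ← forest-extendToLeaf forest S (edge-path (Adj-sym va)) a∈S
    with ℓ₁ , e₁ , leaf₁ , pth₁ , hd₁ ←
           forest-extendToLeaf forest S
             (forest-path-extend forest
               (subst (IsPath G) (reverse-++ e₂ (a ∷ v ∷ [])) (path-reverse pth₂))
               vb (λ eq → a≢b (just-injective eq)))
             b∈S =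
    ℓ₁ , ℓ₂ , leaf₁ , leaf₂ , _ , (forest⇒trianglePath forest pth₁ , hd₁ , ends-at-ℓ₂) ,
    ∈-++⁺ʳ e₁ (there (here refl))
    where
    open ≡-Reasoning
    ends-at-ℓ₂ : last (e₁ ++ b ∷ v ∷ a ∷ reverse e₂) ≡ just ℓ₂
    ends-at-ℓ₂ = begin
      last (e₁ ++ b ∷ v ∷ a ∷ reverse e₂) ≡⟨ last-++-∷ e₁ b _ ⟩
      last (v ∷ a ∷ reverse e₂)           ≡⟨ cong last (reverse-++ e₂ (a ∷ v ∷ [])) ⟨
      last (reverse (e₂ ++ a ∷ v ∷ []))   ≡⟨ last-reverse (e₂ ++ a ∷ v ∷ []) ⟩
      head (e₂ ++ a ∷ v ∷ [])             ≡⟨ hd₂ ⟩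
      just ℓ₂                             ∎

  forest⇒convexGeometry : IsForest G → IsConvexGeometry G
  forest⇒convexGeometry forest S cS v = mk⇔ inHull (λ h → h S cS (λ _ → proj₁))
    where
    inHull : v ∈ S → InHull G (IsExtreme G S) v
    inHull v∈S C cC ext⊆C with twoNeighboursIn? S v
    ... | no  ¬two = ext⊆C v (leaf⇒extreme cS (v∈S , ¬two))
    ... | yes two with ℓ₁ , ℓ₂ , leaf₁ , leaf₂ , p , tp , v∈p ← forest-leafPathThrough forest S two =
      cC ℓ₁ ℓ₂ (ext⊆C ℓ₁ (leaf⇒extreme cS leaf₁)) (ext⊆C ℓ₂ (leaf⇒extreme cS leaf₂)) p tp v v∈p

mainTheorem2 : (G : Graph) → IsConvexGeometry G ⇔ IsForest G
mainTheorem2 G = mk⇔ (convexGeometry⇒forest G) (forest⇒convexGeometry G)
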